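{- Let $\ell\ge 1$ and $k\ge 2$ be integers with $(\ell,k)\neq(1,2)$. For each $i\in[k]=\{0,1,\ldots,k-1\}$, the set $S_i^k=\{v=v_0v_1\cdots v_{k\ell-1}\in V^\ell_k : v_0=i\}$ is an E$^\ell$-set of the graph $ST^\ell_k$; that is, every vertex $v\in V^\ell_k\setminus S_i^k$ has exactly $\ell$ neighbors in $S_i^k$. In particular, the graphs $ST^\ell_k$ form an E$^\ell$-chain.
   Context: For integers $\ell\ge1$, $k\ge2$, an $\ell$-set permutation is a string over the alphabet $[k]=\{0,\ldots,k-1\}$ containing exactly $\ell$ occurrences of each $i\in[k]$; $V^\ell_k$ denotes the set of all such strings (of length $k\ell$), i.e. all rearrangements of $0^\ell1^\ell\cdots(k-1)^\ell$. The star $\ell$-set transposition graph $ST^\ell_k$ has vertex set $V^\ell_k$, with $v=v_0\cdots v_{k\ell-1}$ adjacent to $w$ iff $w$ is obtained from $v$ by swapping the first entry $v_0$ with some entry $v_j$ ($1\le j\le k\ell-1$) such that $v_j\neq v_0$. For a graph $G$ and integer $\ell\ge1$, a set $S\subseteq V(G)$ is an efficient dominating$^\ell$-set (E$^\ell$-set) if every vertex of $V(G)\setminus S$ is adjacent to exactly $\ell$ vertices of $S$. An E$^\ell$-chain is a countable family of nested graphs each of which has an E$^\ell$-set. -}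

module Defs where

open import Level using (0ℓ)
open import Data.Nat using (ℕ; zero; suc; _*_)
open import Data.Fin using (Fin; zero; suc; _≟_)
open import Data.Vec using (Vec; lookup; count; _[_]≔_)
open import Data.Product using (Σ; ∃; _×_; _,_)
open import Data.Empty using (⊥)
open import Data.List using (List; length)
open import Data.List.Membership.Propositional using (_∈_)
open import Data.List.Relation.Unary.Unique.Propositional using (Unique)
open import Function.Bundles using (_⇔_)
open import Relation.Nullary using (¬_)
open import Relation.Binary.PropositionalEquality using (_≡_; _≢_)

Word : ℕ → ℕ → Set
Word k ℓ = Vec (Fin k) (k * ℓ)

occ : ∀ {k n} → Fin k → Vec (Fin k) n → ℕ
occ i v = count (_≟ i) v

IsLSetPerm : (k ℓ : ℕ) → Word k ℓ → Set
IsLSetPerm k ℓ v = (i : Fin k) → occ i v ≡ ℓ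

swap : ∀ {A : Set} {n} → Vec A n → Fin n → Fin n → Vec A n
swap v p q = (v [ p ]≔ lookup v q) [ q ]≔ lookup v p

StarAdj : ∀ {A : Set} {n} → Vec A n → Vec A n → Set
StarAdj {n = zero} v w = ⊥
StarAdj {n = suc n} v w =
  ∃ λ (j : Fin (suc n)) → j ≢ zero × lookup v j ≢ lookup v zero × w ≡ swap v zero j

record Graph : Set₁ where
  field
    U   : Set
    V   : U → Set
    Adj : U → U → Set

ST : (ℓ k : ℕ) → Graph
ST ℓ k = record { U = Word k ℓ ; V = IsLSetPerm k ℓ ; Adj = StarAdj }

-- S ⊆ V(G) is an E^m-set: every vertex of V(G) ∖ S is adjacent to exactly m
-- vertices of S (exactly m: there is a duplicate-free list of length m whose
-- members are precisely the vertices of S adjacent to v).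
IsEffDomSet : (m : ℕ) (G : Graph) → (Graph.U G → Set) → Set
IsEffDomSet m G S =
  ((u : U) → S u → V u) ×
  ((v : U) → V v → ¬ S v →
     Σ (List U) λ xs → Unique xs × length xs ≡ m ×
       ((w : U) → (w ∈ xs) ⇔ (V w × S w × Adj v w)))
  where open Graph G

Sik : (ℓ k : ℕ) → Fin k → Word k ℓ → Set
Sik ℓ k i v = IsLSetPerm k ℓ v × FirstIs v
  where
  FirstIs : ∀ {n} → Vec (Fin k) n → Set
  FirstIs {zero} _ = ⊥
  FirstIs {suc n} u = lookup u zero ≡ i

{-# OPTIONS --safe #-}
-- A word v = x t with first letter x ≠ i has exactly one neighbour starting with i
-- for every position j ≥ 1 carrying the letter i, namely the word obtained by
-- swapping x and t_j; distinct such positions give distinct words because the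
-- swapped-in x sits at different places. Star transpositions only permute letters,
-- so these neighbours are again ℓ-set permutations, and there are as many of them
-- as occurrences of i in t, which is ℓ because x ≠ i.
module Submission where

open import Defs
open import Data.Nat using (ℕ; _≤_; suc; s≤s)
open import Data.Bool using (true; false; if_then_else_)
open import Data.Fin using (Fin; zero; suc; _≟_)
open import Data.Vec as Vec using (Vec; _∷_; lookup; tail; count; _[_]≔_)
open import Data.Vec.Properties using (lookup∘update; lookup∘update′; tabulate∘lookup)
open import Data.List as List using (List; map; filter; length; allFin)
open import Data.List.Properties using (length-map)
open import Data.List.Membership.Propositional using (_∈_)
open import Data.List.Membership.Propositional.Properties
  using (∈-allFin; ∈-map∘filter⁺; ∈-map∘filter⁻)
open import Data.List.Relation.Unary.All as All using (All; []; _∷_)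
open import Data.List.Relation.Unary.All.Properties using (all-filter) renaming (map⁺ to All-map⁺)
open import Data.List.Relation.Unary.Unique.Propositional using (Unique; []; _∷_)
import Data.List.Relation.Unary.Unique.Propositional.Properties as Unique
open import Data.Product using (Σ; _×_; _,_; proj₁)
open import Function using (id; _∘_)
open import Function.Bundles using (_⇔_; mk⇔; Equivalence)
open import Relation.Nullary using (¬_; does; yes; no; contradiction)
open import Relation.Nullary.Decidable using (decidable-stable)
open import Relation.Unary using (Pred; Decidable)
open import Relation.Binary.Definitions using (DecidableEquality)
open import Relation.Binary.PropositionalEquality
  using (_≡_; _≢_; refl; sym; trans; cong; module ≡-Reasoning)

open ≡-Reasoning

private
  variable
    A B : Set
    n : ℕ

swap₀ : Vec A (suc n) → Fin n → Vec A (suc n)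
swap₀ v j = swap v zero (suc j)

module _ {p} {P : Pred A p} (P? : Decidable P) where

  count-swap-heads : ∀ a b (t : Vec A n) → count P? (a ∷ b ∷ t) ≡ count P? (b ∷ a ∷ t)
  count-swap-heads a b t with does (P? a) | does (P? b)
  ... | true  | true  = refl
  ... | true  | false = refl
  ... | false | true  = refl
  ... | false | false = refl

  count-swap₀ : ∀ (x : A) (t : Vec A n) j → count P? (swap₀ (x ∷ t) j) ≡ count P? (x ∷ t)
  count-swap₀ x (y ∷ t) zero    = count-swap-heads y x t
  count-swap₀ x (y ∷ t) (suc j) = begin
    count P? (lookup t j ∷ y ∷ t [ j ]≔ x) ≡⟨ count-swap-heads (lookup t j) y (t [ j ]≔ x) ⟩
    count P? (y ∷ lookup t j ∷ t [ j ]≔ x) ≡⟨ cong (if does (P? y) then suc else id) (count-swap₀ x t j) ⟩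
    count P? (y ∷ x ∷ t)                   ≡⟨ count-swap-heads y x t ⟩
    count P? (x ∷ y ∷ t)                   ∎

  count-reject : ∀ {x} (t : Vec A n) → ¬ P x → count P? (x ∷ t) ≡ count P? t
  count-reject {x = x} t ¬px with P? x
  ... | yes px = contradiction px ¬px
  ... | no  _  = refl

  count-StarAdj : {v w : Vec A n} → StarAdj v w → count P? w ≡ count P? v
  count-StarAdj {v = x ∷ t} (zero  , 0≢0 , _) = contradiction refl 0≢0
  count-StarAdj {v = x ∷ t} (suc j , _ , _ , refl) = count-swap₀ x t j

  length-filter-tabulate : (f : B → A) (g : Fin n → B) →
    length (filter (P? ∘ f) (List.tabulate g)) ≡ count P? (Vec.tabulate (f ∘ g))
  length-filter-tabulate {n = 0}     f g = refl
  length-filter-tabulate {n = suc n} f g with does (P? (f (g zero)))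
  ... | true  = cong suc (length-filter-tabulate f (g ∘ suc))
  ... | false = length-filter-tabulate f (g ∘ suc)

  indicesWhere : Vec A n → List (Fin n)
  indicesWhere {n} t = filter (P? ∘ lookup t) (allFin n)

  length-indicesWhere : (t : Vec A n) → length (indicesWhere t) ≡ count P? t
  length-indicesWhere t = trans (length-filter-tabulate (lookup t) id) (cong (count P?) (tabulate∘lookup t))

Unique-map⁺ : ∀ {p} {P : Pred A p} {f : A → B} {xs : List A} →
  (∀ {a b} → P a → f a ≡ f b → a ≡ b) → All P xs → Unique xs → Unique (map f xs)
Unique-map⁺ inj []         []            = []
Unique-map⁺ inj (pa ∷ pxs) (a∉xs ∷ uxs) =
  All-map⁺ (All.map (λ a≢b fa≡fb → a≢b (inj pa fa≡fb)) a∉xs) ∷ Unique-map⁺ inj pxs uxs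

swap₀-injective : ∀ {x : A} {t : Vec A n} {a b} →
  lookup t a ≢ x → swap₀ (x ∷ t) a ≡ swap₀ (x ∷ t) b → a ≡ b
swap₀-injective {x = x} {t} {a} {b} tₐ≢x eq = decidable-stable (a ≟ b) λ a≢b → tₐ≢x (begin
  lookup t a            ≡⟨ lookup∘update′ a≢b t x ⟨
  lookup (t [ b ]≔ x) a ≡⟨ cong (λ w → lookup (tail w) a) eq ⟨
  lookup (t [ a ]≔ x) a ≡⟨ lookup∘update a t x ⟩
  x                     ∎)

module StarNeighboursStartingWith (_≟ᴬ_ : DecidableEquality A) (i x : A) (t : Vec A n) (x≢i : x ≢ i) where

  neighboursStartingWith : List (Vec A (suc n))
  neighboursStartingWith = map (swap₀ (x ∷ t)) (indicesWhere (_≟ᴬ i) t)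

  neighboursStartingWith-unique : Unique neighboursStartingWith
  neighboursStartingWith-unique =
    Unique-map⁺ (λ tₐ≡i → swap₀-injective (λ tₐ≡x → x≢i (trans (sym tₐ≡x) tₐ≡i)))
      (all-filter _ (allFin n)) (Unique.filter⁺ _ (Unique.allFin⁺ n))

  length-neighboursStartingWith : length neighboursStartingWith ≡ count (_≟ᴬ i) (x ∷ t)
  length-neighboursStartingWith = begin
    length neighboursStartingWith        ≡⟨ length-map (swap₀ (x ∷ t)) (indicesWhere (_≟ᴬ i) t) ⟩
    length (indicesWhere (_≟ᴬ i) t)     ≡⟨ length-indicesWhere (_≟ᴬ i) t ⟩
    count (_≟ᴬ i) t                     ≡⟨ count-reject (_≟ᴬ i) t x≢i ⟨
    count (_≟ᴬ i) (x ∷ t)               ∎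

  ∈-neighboursStartingWith : ∀ w →
    w ∈ neighboursStartingWith ⇔ (lookup w zero ≡ i × StarAdj (x ∷ t) w)
  ∈-neighboursStartingWith w = mk⇔ to from
    where
    to : w ∈ neighboursStartingWith → lookup w zero ≡ i × StarAdj (x ∷ t) w
    to w∈ with ∈-map∘filter⁻ (swap₀ (x ∷ t)) (_≟ᴬ i ∘ lookup t) {xs = allFin n} w∈
    ... | j , _ , refl , tⱼ≡i = tⱼ≡i , suc j , (λ ()) , (λ tⱼ≡x → x≢i (trans (sym tⱼ≡x) tⱼ≡i)) , refl
    from : lookup w zero ≡ i × StarAdj (x ∷ t) w → w ∈ neighboursStartingWith
    from (_    , zero  , 0≢0 , _) = contradiction refl 0≢0
    from (tⱼ≡i , suc j , _ , _ , refl) =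
      ∈-map∘filter⁺ (swap₀ (x ∷ t)) (_≟ᴬ i ∘ lookup t) {xs = allFin n} (j , ∈-allFin j , refl , tⱼ≡i)

IsLSetPerm-StarAdj : ∀ {k ℓ} {v w : Word k ℓ} → StarAdj v w → IsLSetPerm k ℓ v → IsLSetPerm k ℓ w
IsLSetPerm-StarAdj adj v∈V c = trans (count-StarAdj (_≟ c) adj) (v∈V c)

theorem1 : (ℓ k : ℕ) → 1 ≤ ℓ → 2 ≤ k → ¬ (ℓ ≡ 1 × k ≡ 2) →
    (i : Fin k) → IsEffDomSet ℓ (ST ℓ k) (Sik ℓ k i)
theorem1 (suc ℓ) (suc k) (s≤s _) (s≤s _) _ i = (λ _ → proj₁) , neighbours
  where
  open Graph (ST (suc ℓ) (suc k))
  S : U → Set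
  S = Sik (suc ℓ) (suc k) i

  neighbours : (v : U) → V v → ¬ S v →
    Σ (List U) λ ws → Unique ws × length ws ≡ suc ℓ × (∀ w → w ∈ ws ⇔ (V w × S w × Adj v w))
  neighbours (x ∷ t) v∈V v∉S = neighboursStartingWith , neighboursStartingWith-unique ,
    trans length-neighboursStartingWith (v∈V i) ,
    λ w → mk⇔ (λ w∈ → let w₀≡i , adj = to (∈-neighboursStartingWith w) w∈
                       in IsLSetPerm-StarAdj adj v∈V , (IsLSetPerm-StarAdj adj v∈V , w₀≡i) , adj)
              (λ (_ , (_ , w₀≡i) , adj) → from (∈-neighboursStartingWith w) (w₀≡i , adj))
    where
    x≢i : x ≢ i
    x≢i x≡i = v∉S (v∈V , x≡i)
    open StarNeighboursStartingWith _≟_ i x t x≢i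
    open Equivalence
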